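{- Let $p$ be a prime and $j\geq1$ an integer. For every integer $i\geq0$, any $p^i$-fold base-$p$ addition of $p^j-1$ produces exactly $(p^i-1)j$ carries.
   Context: A carry in a base-$p$ addition of two nonnegative integers occurs at a position when the digit sum plus the incoming carry is at least $p$. An $m$-fold base-$p$ addition of $N$ is a fully parenthesized addition of $m$ copies of $N$ (each pair of parentheses encloses exactly two summands), and its number of carries is the total over all binary additions performed. -}

module Defs where

open import Data.Nat using (ℕ; zero; suc; _+_; _*_; _∸_; _^_; _≤ᵇ_; NonZero)
open import Data.Nat.DivMod using (_/_; _%_)
open import Data.Nat.Properties using (m^n≢0)
open import Data.Bool using (if_then_else_)

digit : (p : ℕ) → .{{NonZero p}} → ℕ → ℕ → ℕ
digit p a k = (a / p ^ k) {{m^n≢0 p k}} % p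

-- carryIn p a b k : the carry (0 or 1) coming into position k when adding a and b in base p.
-- No carry into position 0; a carry out of position k occurs iff
-- digit a k + digit b k + carry-in ≥ p.
carryIn : (p : ℕ) → .{{NonZero p}} → ℕ → ℕ → ℕ → ℕ
carryIn p a b zero = 0
carryIn p a b (suc k) =
  if p ≤ᵇ (digit p a k + digit p b k + carryIn p a b k) then 1 else 0

carriesUpTo : (p : ℕ) → .{{NonZero p}} → ℕ → ℕ → ℕ → ℕ
carriesUpTo p a b zero = 0
carriesUpTo p a b (suc k) = carriesUpTo p a b k + carryIn p a b (suc k)

-- total number of carries in the base-p addition a + b.
-- Positions ≥ a + b + 1 exceed the number of digits of a + b, so no carries occur there.
carries : (p : ℕ) → .{{NonZero p}} → ℕ → ℕ → ℕ
carries p a b = carriesUpTo p a b (suc (a + b))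

-- fully parenthesized additions: full binary trees whose leaves are the summands
data AddTree : Set where
  leaf : AddTree
  node : AddTree → AddTree → AddTree

leaves : AddTree → ℕ
leaves leaf = 1
leaves (node l r) = leaves l + leaves r

value : ℕ → AddTree → ℕ
value N leaf = N
value N (node l r) = value N l + value N r

totalCarries : (p : ℕ) → .{{NonZero p}} → ℕ → AddTree → ℕ
totalCarries p N leaf = 0
totalCarries p N (node l r) =
  totalCarries p N l + totalCarries p N r + carries p (value N l) (value N r)

-- Kummer's theorem in additive form: adding a and b in base p, the digit sums
-- satisfy s(a) + s(b) = s(a + b) + (p − 1)·(number of carries).  Summing this
-- over the nodes of an addition tree telescopes to
--   (#summands)·s(N) = s(value) + (p − 1)·(total carries).
-- For N = p^j − 1 (j digits p − 1) and p^i summands the value is p^i·N, whose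
-- digits are those of N shifted by i places, so both digit sums equal j(p − 1)
-- and the total number of carries is (p^i − 1)·j.
module Submission where

open import Data.Bool using (true; false; if_then_else_)
open import Data.Nat
open import Data.Nat.DivMod
open import Data.Nat.Divisibility using (divides)
open import Data.Nat.Primality using (Prime; prime⇒nonZero; prime⇒nonTrivial)
open import Data.Nat.Properties
open import Algebra.Properties.CommutativeSemigroup +-commutativeSemigroup using (interchange; x∙yz≈y∙xz)
open import Data.Nat.Tactic.RingSolver using (solve-∀)
open import Relation.Binary.PropositionalEquality
open import Relation.Nullary.Reflects using (ofʸ; ofⁿ)

open import Defs

value≡leaves*N : ∀ N t → value N t ≡ leaves t * N
value≡leaves*N N leaf       = sym (*-identityˡ N)
value≡leaves*N N (node l r) = begin
  value N l + value N r       ≡⟨ cong₂ _+_ (value≡leaves*N N l) (value≡leaves*N N r) ⟩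
  leaves l * N + leaves r * N ≡⟨ *-distribʳ-+ N (leaves l) (leaves r) ⟨
  (leaves l + leaves r) * N   ∎
  where open ≡-Reasoning

m*n∸1≡[m∸1]+[n∸1]*m : ∀ {m n} → 0 < m → 0 < n → m * n ∸ 1 ≡ (m ∸ 1) + (n ∸ 1) * m
m*n∸1≡[m∸1]+[n∸1]*m {suc a} {suc b} _ _ = regroup a b
  where
  regroup : ∀ a b → b + a * suc b ≡ a + b * suc a
  regroup = solve-∀

P*[j*q]≡j*q+q*T⇒T≡[P∸1]*j : ∀ {q} .{{_ : NonZero q}} P j T → 0 < P →
  P * (j * q) ≡ j * q + q * T → T ≡ (P ∸ 1) * j
P*[j*q]≡j*q+q*T⇒T≡[P∸1]*j {q} (suc m) j T _ eq =
  *-cancelˡ-≡ T (m * j) q (sym (trans (reorder q m j) (+-cancelˡ-≡ (j * q) (m * (j * q)) (q * T) eq)))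
  where
  reorder : ∀ q m j → q * (m * j) ≡ m * (j * q)
  reorder = solve-∀

module _ (p : ℕ) {{_ : NonTrivial p}} where

  instance
    p≢0 : NonZero p
    p≢0 = nonTrivial⇒nonZero p

  infixl 8 _≫_
  _≫_ : ℕ → ℕ → ℕ
  x ≫ k = (x / p ^ k) {{m^n≢0 p k}}

  open ≡-Reasoning

  p≡1+[p∸1] : p ≡ suc (p ∸ 1)
  p≡1+[p∸1] = sym (m+[n∸m]≡n (<⇒≤ (nonTrivial⇒n>1 p)))

  n<p^n : ∀ n → n < p ^ n
  n<p^n zero    = z<s
  n<p^n (suc n) = ≤-<-trans (n<p^n n) p^n<p^[1+n]
    where
    p^n<p^[1+n] : p ^ n < p * p ^ n
    p^n<p^[1+n] = <-≤-trans (m<m*n (p ^ n) p {{m^n≢0 p n}} (nonTrivial⇒n>1 p)) (≤-reflexive (*-comm (p ^ n) p))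

  ≫-suc : ∀ x k → x ≫ suc k ≡ x ≫ k / p
  ≫-suc x k = sym (trans
    (m/n/o≡m/[n*o] x (p ^ k) p {{m^n≢0 p k}} {{_}} {{m*n≢0 (p ^ k) p {{m^n≢0 p k}}}})
    (/-congʳ {{m*n≢0 (p ^ k) p {{m^n≢0 p k}}}} {{m^n≢0 p (suc k)}} (*-comm (p ^ k) p)))

  ≫-sucʳ : ∀ x k → x ≫ suc k ≡ (x / p) ≫ k
  ≫-sucʳ x k = sym (m/n/o≡m/[n*o] x p (p ^ k) {{_}} {{m^n≢0 p k}} {{m^n≢0 p (suc k)}})

  digit-suc : ∀ x k → digit p x (suc k) ≡ digit p (x / p) k
  digit-suc x k = cong (_% p) (≫-sucʳ x k)

  split-+ : ∀ A B c → A + B + c ≡ (A % p + B % p + c) + (A / p + B / p) * p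
  split-+ A B c = begin
    A + B + c                                     ≡⟨ cong₂ (λ x y → x + y + c) (m≡m%n+[m/n]*n A p) (m≡m%n+[m/n]*n B p) ⟩
    (A % p + A / p * p) + (B % p + B / p * p) + c ≡⟨ regroup (A % p) (A / p) (B % p) (B / p) c p ⟩
    (A % p + B % p + c) + (A / p + B / p) * p     ∎
    where
    regroup : ∀ a a′ b b′ c p → (a + a′ * p) + (b + b′ * p) + c ≡ (a + b + c) + (a′ + b′) * p
    regroup = solve-∀

  +-%-split : ∀ A B c → (A + B + c) % p ≡ (A % p + B % p + c) % p
  +-%-split A B c = begin
    (A + B + c) % p                               ≡⟨ cong (_% p) (split-+ A B c) ⟩
    (A % p + B % p + c + (A / p + B / p) * p) % p ≡⟨ [m+kn]%n≡m%n (A % p + B % p + c) (A / p + B / p) p ⟩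
    (A % p + B % p + c) % p                       ∎

  +-/-split : ∀ A B c → (A + B + c) / p ≡ A / p + B / p + (A % p + B % p + c) / p
  +-/-split A B c = begin
    (A + B + c) / p                                 ≡⟨ cong (_/ p) (split-+ A B c) ⟩
    (Y + K * p) / p                                 ≡⟨ +-distrib-/-∣ʳ Y (divides K refl) ⟩
    Y / p + K * p / p                               ≡⟨ cong (Y / p +_) (m*n/n≡m K p) ⟩
    Y / p + K                                       ≡⟨ +-comm (Y / p) K ⟩
    K + Y / p                                       ∎
    where
    Y = A % p + B % p + c
    K = A / p + B / p

  carryBit : ℕ → ℕ
  carryBit Y = if p ≤ᵇ Y then 1 else 0

  carryBit≤1 : ∀ Y → carryBit Y ≤ 1
  carryBit≤1 Y with p ≤ᵇ Y
  ... | true  = ≤-refl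
  ... | false = z≤n

  /-carryBit : ∀ Y → Y < p + p → Y / p ≡ carryBit Y
  /-carryBit Y Y<2p with p ≤ᵇ Y | ≤ᵇ-reflects-≤ p Y
  ... | true  | ofʸ p≤Y = begin
    Y / p           ≡⟨ m/n≡1+[m∸n]/n p≤Y ⟩
    1 + (Y ∸ p) / p ≡⟨ cong (1 +_) (m<n⇒m/n≡0 (m<n+o⇒m∸n<o Y p Y<2p)) ⟩
    1               ∎
  ... | false | ofⁿ p≰Y = m<n⇒m/n≡0 (≰⇒> p≰Y)

  digits+carry<2p : ∀ A B {c} → c ≤ 1 → A % p + B % p + c < p + p
  digits+carry<2p A B {c} c≤1 =
    subst (_< p + p) (sym (+-assoc (A % p) (B % p) c)) (+-mono-<-≤ (m%n<n A p) B%p+c≤p)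
    where
    B%p+c≤p : B % p + c ≤ p
    B%p+c≤p = ≤-trans (+-monoʳ-≤ (B % p) c≤1) (≤-trans (≤-reflexive (+-comm (B % p) 1)) (m%n<n B p))

  carryIn≤1 : ∀ a b k → carryIn p a b k ≤ 1
  carryIn≤1 a b zero    = z≤n
  carryIn≤1 a b (suc k) = carryBit≤1 _

  carryIn-suc : ∀ a b k →
    carryIn p a b (suc k) ≡ (digit p a k + digit p b k + carryIn p a b k) / p
  carryIn-suc a b k =
    sym (/-carryBit _ (digits+carry<2p (a ≫ k) (b ≫ k) (carryIn≤1 a b k)))

  +-≫ : ∀ a b k → (a + b) ≫ k ≡ a ≫ k + b ≫ k + carryIn p a b k
  +-≫ a b zero    = begin
    (a + b) / 1       ≡⟨ n/1≡n (a + b) ⟩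
    a + b             ≡⟨ cong₂ _+_ (n/1≡n a) (n/1≡n b) ⟨
    a / 1 + b / 1     ≡⟨ +-identityʳ _ ⟨
    a / 1 + b / 1 + 0 ∎
  +-≫ a b (suc k) = begin
    (a + b) ≫ suc k                             ≡⟨ ≫-suc (a + b) k ⟩
    (a + b) ≫ k / p                             ≡⟨ cong (_/ p) (+-≫ a b k) ⟩
    (a ≫ k + b ≫ k + carryIn p a b k) / p       ≡⟨ +-/-split (a ≫ k) (b ≫ k) (carryIn p a b k) ⟩
    a ≫ k / p + b ≫ k / p + Y / p               ≡⟨ cong₂ (λ x y → x + y + Y / p) (≫-suc a k) (≫-suc b k) ⟨
    a ≫ suc k + b ≫ suc k + Y / p               ≡⟨ cong (a ≫ suc k + b ≫ suc k +_) (carryIn-suc a b k) ⟨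
    a ≫ suc k + b ≫ suc k + carryIn p a b (suc k) ∎
    where
    Y = digit p a k + digit p b k + carryIn p a b k

  digit-+ : ∀ a b k →
    digit p a k + digit p b k + carryIn p a b k ≡ digit p (a + b) k + p * carryIn p a b (suc k)
  digit-+ a b k = begin
    Y                                   ≡⟨ m≡m%n+[m/n]*n Y p ⟩
    Y % p + Y / p * p                   ≡⟨ cong₂ (λ x y → x + y * p) digit[a+b]≡Y%p (carryIn-suc a b k) ⟨
    digit p (a + b) k + carryIn p a b (suc k) * p ≡⟨ cong (digit p (a + b) k +_) (*-comm _ p) ⟩
    digit p (a + b) k + p * carryIn p a b (suc k) ∎
    where
    Y = digit p a k + digit p b k + carryIn p a b k
    digit[a+b]≡Y%p : digit p (a + b) k ≡ Y % p
    digit[a+b]≡Y%p = trans (cong (_% p) (+-≫ a b k)) (+-%-split (a ≫ k) (b ≫ k) (carryIn p a b k))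

  carryIn-vanish : ∀ a b k → a + b < p ^ k → carryIn p a b k ≡ 0
  carryIn-vanish a b k a+b<p^k =
    m+n≡0⇒n≡0 (a ≫ k + b ≫ k) (trans (sym (+-≫ a b k)) (m<n⇒m/n≡0 {{m^n≢0 p k}} a+b<p^k))

  carriesUpTo-stable : ∀ a b k → a + b < p ^ k → ∀ m → carriesUpTo p a b (m + k) ≡ carriesUpTo p a b k
  carriesUpTo-stable a b k a+b<p^k zero    = refl
  carriesUpTo-stable a b k a+b<p^k (suc m) = begin
    carriesUpTo p a b (m + k) + carryIn p a b (suc (m + k))
      ≡⟨ cong₂ _+_ (carriesUpTo-stable a b k a+b<p^k m) (carryIn-vanish a b (suc (m + k)) a+b<p^[1+m+k]) ⟩
    carriesUpTo p a b k + 0 ≡⟨ +-identityʳ _ ⟩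
    carriesUpTo p a b k     ∎
    where
    a+b<p^[1+m+k] : a + b < p ^ suc (m + k)
    a+b<p^[1+m+k] = <-≤-trans a+b<p^k (^-monoʳ-≤ p (≤-trans (m≤n+m k m) (n≤1+n (m + k))))

  carriesUpTo≡carries : ∀ a b n → a + b < n → carriesUpTo p a b n ≡ carries p a b
  carriesUpTo≡carries a b n a+b<n = begin
    carriesUpTo p a b n                             ≡⟨ cong (carriesUpTo p a b) (m∸n+n≡m a+b<n) ⟨
    carriesUpTo p a b (n ∸ suc (a + b) + suc (a + b)) ≡⟨ carriesUpTo-stable a b (suc (a + b)) a+b<p^[1+a+b] (n ∸ suc (a + b)) ⟩
    carries p a b                                   ∎
    where
    a+b<p^[1+a+b] : a + b < p ^ suc (a + b)
    a+b<p^[1+a+b] = <-trans (n<1+n (a + b)) (n<p^n (suc (a + b)))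

  digitSum : ℕ → ℕ → ℕ
  digitSum zero    x = 0
  digitSum (suc n) x = digitSum n x + digit p x n

  digitSum-+-carriesUpTo : ∀ a b n →
    digitSum n a + digitSum n b ≡ digitSum n (a + b) + (p ∸ 1) * carriesUpTo p a b n + carryIn p a b n
  digitSum-+-carriesUpTo a b zero    = sym (trans (+-identityʳ _) (*-zeroʳ (p ∸ 1)))
  digitSum-+-carriesUpTo a b (suc n) = begin
    (digitSum n a + digit p a n) + (digitSum n b + digit p b n)
      ≡⟨ interchange (digitSum n a) (digit p a n) (digitSum n b) (digit p b n) ⟩
    (digitSum n a + digitSum n b) + (digit p a n + digit p b n)
      ≡⟨ cong (_+ (digit p a n + digit p b n)) (digitSum-+-carriesUpTo a b n) ⟩
    (S + q * C + carryIn p a b n) + (digit p a n + digit p b n)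
      ≡⟨ +-assoc (S + q * C) _ _ ⟩
    S + q * C + (carryIn p a b n + (digit p a n + digit p b n))
      ≡⟨ cong (S + q * C +_) (+-comm (carryIn p a b n) _) ⟩
    S + q * C + (digit p a n + digit p b n + carryIn p a b n)
      ≡⟨ cong (S + q * C +_) (digit-+ a b n) ⟩
    S + q * C + (digit p (a + b) n + p * c′)
      ≡⟨ cong (λ p′ → S + q * C + (digit p (a + b) n + p′ * c′)) p≡1+[p∸1] ⟩
    S + q * C + (digit p (a + b) n + suc q * c′)
      ≡⟨ regroup S (digit p (a + b) n) q C c′ ⟩
    (S + digit p (a + b) n) + q * (C + c′) + c′ ∎
    where
    S  = digitSum n (a + b)
    q  = p ∸ 1
    C  = carriesUpTo p a b n
    c′ = carryIn p a b (suc n)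
    regroup : ∀ s d q C c → s + q * C + (d + suc q * c) ≡ (s + d) + q * (C + c) + c
    regroup = solve-∀

  digitSum-+ : ∀ a b n → a + b < n →
    digitSum n a + digitSum n b ≡ digitSum n (a + b) + (p ∸ 1) * carries p a b
  digitSum-+ a b n a+b<n = begin
    digitSum n a + digitSum n b
      ≡⟨ digitSum-+-carriesUpTo a b n ⟩
    digitSum n (a + b) + (p ∸ 1) * carriesUpTo p a b n + carryIn p a b n
      ≡⟨ cong₂ (λ C c → digitSum n (a + b) + (p ∸ 1) * C + c) (carriesUpTo≡carries a b n a+b<n) c≡0 ⟩
    digitSum n (a + b) + (p ∸ 1) * carries p a b + 0
      ≡⟨ +-identityʳ _ ⟩
    digitSum n (a + b) + (p ∸ 1) * carries p a b ∎
    where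
    c≡0 : carryIn p a b n ≡ 0
    c≡0 = carryIn-vanish a b n (<-trans a+b<n (n<p^n n))

  leaves*digitSum : ∀ N n t → value N t < n →
    leaves t * digitSum n N ≡ digitSum n (value N t) + (p ∸ 1) * totalCarries p N t
  leaves*digitSum N n leaf _ = begin
    1 * digitSum n N             ≡⟨ *-identityˡ _ ⟩
    digitSum n N                 ≡⟨ +-identityʳ _ ⟨
    digitSum n N + 0             ≡⟨ cong (digitSum n N +_) (*-zeroʳ (p ∸ 1)) ⟨
    digitSum n N + (p ∸ 1) * 0   ∎
  leaves*digitSum N n (node l r) v<n = begin
    (leaves l + leaves r) * s
      ≡⟨ *-distribʳ-+ s (leaves l) (leaves r) ⟩
    leaves l * s + leaves r * s
      ≡⟨ cong₂ _+_ (leaves*digitSum N n l vl<n) (leaves*digitSum N n r vr<n) ⟩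
    (digitSum n vl + q * tl) + (digitSum n vr + q * tr)
      ≡⟨ interchange (digitSum n vl) (q * tl) (digitSum n vr) (q * tr) ⟩
    (digitSum n vl + digitSum n vr) + (q * tl + q * tr)
      ≡⟨ cong₂ _+_ (digitSum-+ vl vr n v<n) (sym (*-distribˡ-+ q tl tr)) ⟩
    (digitSum n (vl + vr) + q * c) + q * (tl + tr)
      ≡⟨ +-assoc (digitSum n (vl + vr)) (q * c) (q * (tl + tr)) ⟩
    digitSum n (vl + vr) + (q * c + q * (tl + tr))
      ≡⟨ cong (digitSum n (vl + vr) +_) (*-distribˡ-+ q c (tl + tr)) ⟨
    digitSum n (vl + vr) + q * (c + (tl + tr))
      ≡⟨ cong (λ x → digitSum n (vl + vr) + q * x) (+-comm c (tl + tr)) ⟩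
    digitSum n (vl + vr) + q * (tl + tr + c) ∎
    where
    s  = digitSum n N
    q  = p ∸ 1
    vl = value N l
    vr = value N r
    tl = totalCarries p N l
    tr = totalCarries p N r
    c  = carries p vl vr
    vl<n : vl < n
    vl<n = ≤-<-trans (m≤m+n vl vr) v<n
    vr<n : vr < n
    vr<n = ≤-<-trans (m≤n+m vr vl) v<n

  digitSum-suc : ∀ n x → digitSum (suc n) x ≡ x % p + digitSum n (x / p)
  digitSum-suc zero    x = trans (cong (_% p) (n/1≡n x)) (sym (+-identityʳ _))
  digitSum-suc (suc n) x = begin
    digitSum (suc n) x + digit p x (suc n)             ≡⟨ cong₂ _+_ (digitSum-suc n x) (digit-suc x n) ⟩
    x % p + digitSum n (x / p) + digit p (x / p) n     ≡⟨ +-assoc (x % p) _ _ ⟩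
    x % p + digitSum (suc n) (x / p)                   ∎

  digitSum-+*p : ∀ n {r} k → r < p → digitSum (suc n) (r + k * p) ≡ r + digitSum n k
  digitSum-+*p n {r} k r<p = begin
    digitSum (suc n) (r + k * p)                               ≡⟨ digitSum-suc n (r + k * p) ⟩
    (r + k * p) % p + digitSum n ((r + k * p) / p)             ≡⟨ cong₂ (λ x y → x + digitSum n y) %≡r /≡k ⟩
    r + digitSum n k                                           ∎
    where
    %≡r : (r + k * p) % p ≡ r
    %≡r = trans ([m+kn]%n≡m%n r k p) (m<n⇒m%n≡m r<p)
    /≡k : (r + k * p) / p ≡ k
    /≡k = begin
      (r + k * p) / p   ≡⟨ +-distrib-/-∣ʳ r (divides k refl) ⟩
      r / p + k * p / p ≡⟨ cong₂ _+_ (m<n⇒m/n≡0 r<p) (m*n/n≡m k p) ⟩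
      k                 ∎

  digitSum-zero : ∀ n → digitSum n 0 ≡ 0
  digitSum-zero zero    = refl
  digitSum-zero (suc n) = trans (digitSum-+*p n 0 (>-nonZero⁻¹ p)) (digitSum-zero n)

  digitSum-p^i* : ∀ i n x → digitSum (i + n) (p ^ i * x) ≡ digitSum n x
  digitSum-p^i* zero    n x = cong (digitSum n) (*-identityˡ x)
  digitSum-p^i* (suc i) n x = begin
    digitSum (suc (i + n)) (p * p ^ i * x) ≡⟨ cong (digitSum (suc (i + n))) p*p^i*x≡p^i*x*p ⟩
    digitSum (suc (i + n)) (p ^ i * x * p) ≡⟨ digitSum-+*p (i + n) (p ^ i * x) (>-nonZero⁻¹ p) ⟩
    digitSum (i + n) (p ^ i * x)           ≡⟨ digitSum-p^i* i n x ⟩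
    digitSum n x                           ∎
    where
    p*p^i*x≡p^i*x*p : p * p ^ i * x ≡ p ^ i * x * p
    p*p^i*x≡p^i*x*p = trans (*-assoc p (p ^ i) x) (*-comm p (p ^ i * x))

  digitSum-p^j∸1 : ∀ j n → digitSum (j + n) (p ^ j ∸ 1) ≡ j * (p ∸ 1)
  digitSum-p^j∸1 zero    n = digitSum-zero n
  digitSum-p^j∸1 (suc j) n = begin
    digitSum (suc (j + n)) (p ^ suc j ∸ 1)
      ≡⟨ cong (digitSum (suc (j + n))) (m*n∸1≡[m∸1]+[n∸1]*m (>-nonZero⁻¹ p) (m^n>0 p j)) ⟩
    digitSum (suc (j + n)) ((p ∸ 1) + (p ^ j ∸ 1) * p)
      ≡⟨ digitSum-+*p (j + n) (p ^ j ∸ 1) (≤-reflexive (sym p≡1+[p∸1])) ⟩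
    (p ∸ 1) + digitSum (j + n) (p ^ j ∸ 1)
      ≡⟨ cong ((p ∸ 1) +_) (digitSum-p^j∸1 j n) ⟩
    (p ∸ 1) + j * (p ∸ 1)
      ∎

  totalCarries-p^j∸1 : ∀ j i t → leaves t ≡ p ^ i → totalCarries p (p ^ j ∸ 1) t ≡ (p ^ i ∸ 1) * j
  totalCarries-p^j∸1 j i t leaves≡p^i =
    P*[j*q]≡j*q+q*T⇒T≡[P∸1]*j {{q≢0}} (p ^ i) j (totalCarries p N t) (m^n>0 p i) (begin
      p ^ i * (j * q)                          ≡⟨ cong₂ _*_ leaves≡p^i sN ⟨
      leaves t * digitSum n N                  ≡⟨ leaves*digitSum N n t V<n ⟩
      digitSum n V + q * totalCarries p N t    ≡⟨ cong (_+ q * totalCarries p N t) sV ⟩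
      j * q + q * totalCarries p N t           ∎)
    where
    q = p ∸ 1
    q≢0 : NonZero q
    q≢0 = >-nonZero (m<n⇒0<n∸m (nonTrivial⇒n>1 p))
    N = p ^ j ∸ 1
    V = value N t
    -- any n > V works; this one has the shapes i + _ and j + _ that the digit-sum lemmas need
    n = i + (j + suc V)
    V<n : V < n
    V<n = ≤-trans (m≤n+m (suc V) j) (m≤n+m (j + suc V) i)
    sN : digitSum n N ≡ j * q
    sN = trans (cong (λ m → digitSum m N) (x∙yz≈y∙xz i j (suc V))) (digitSum-p^j∸1 j (i + suc V))
    sV : digitSum n V ≡ j * q
    sV = begin
      digitSum n V               ≡⟨ cong (digitSum n) (trans (value≡leaves*N N t) (cong (_* N) leaves≡p^i)) ⟩
      digitSum n (p ^ i * N)     ≡⟨ digitSum-p^i* i (j + suc V) N ⟩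
      digitSum (j + suc V) N     ≡⟨ digitSum-p^j∸1 j (suc V) ⟩
      j * q                      ∎

lemma5 : (p : ℕ) (pp : Prime p) (j : ℕ) → j ≥ 1 → (i : ℕ) → (t : AddTree) → leaves t ≡ p ^ i →
    totalCarries p {{prime⇒nonZero pp}} (p ^ j ∸ 1) t ≡ (p ^ i ∸ 1) * j
lemma5 p pp j _ = totalCarries-p^j∸1 p {{prime⇒nonTrivial pp}} j
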